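{- Consider any execution of a finite parallel composition of the simplified find-or-put procedure $\mathrm{Fop}$ (described in the context) on a table $T$, with no other process accessing $T$, starting with $T$ well-formed. Then every step of every process preserves well-formedness of $T$; in particular $T$ is well-formed in every state of the execution.
   Context: Let $K$ be a set of keys and fix positive integers $B_0,B_1$. A table $T=(T_0,T_1)$ consists of a primary array $T_0$ of buckets, each with $B_0$ slots $T_0[c][0..B_0-1]$, and a secondary array $T_1$ of buckets, each with $B_1$ slots $T_1[c][0..B_1-1]$. Each slot holds a distinguished value $\mathrm{EMPTY}$ or another value. Given are address functions $a_0$ (into bucket indices of $T_0$), $a_1,a_2$ (into bucket indices of $T_1$), and remainder functions $r_0,r_1,r_2$ on $K$ with values different from $\mathrm{EMPTY}$. Put $r'_0(k)=r_0(k)$, $r'_1(k)=(r_1(k),0)$, $r'_2(k)=(r_2(k),1)$, $\operatorname{sg}(0)=0$, $\operatorname{sg}(1)=\operatorname{sg}(2)=1$, and $S=\{0\}\times\{0,\dots,B_0-1\}\cup\{1,2\}\times\{0,\dots,B_1-1\}$. The total order $\prec$ on $S$: $(0,y)\prec(1+i,z)$ for all $y,z$, $i\in\{0,1\}$; $(x,y)\prec(x,z)$ iff $y<z$; $(1,y)\prec(2,z)$ iff $y<z$ (equivalently $(2,z)\prec(1,y)$ iff $z\le y$). $T$ is well-formed if (i) every slot of $T_0[c]$ is $\mathrm{EMPTY}$ or $r'_0(k)$ for some $k$ with $a_0(k)=c$, and every slot of $T_1[c]$ is $\mathrm{EMPTY}$ or $r'_x(k)$ for some $x\in\{1,2\}$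 and $k$ with $a_x(k)=c$; and (ii) (order property) whenever $T_{\operatorname{sg}(x)}[a_x(k)][y]=r'_x(k)$, then $T_{\operatorname{sg}(x')}[a_{x'}(k)][y']\notin\{\mathrm{EMPTY},r'_{x'}(k)\}$ for all $(x',y')\prec(x,y)$. Simplified find-or-put $\mathrm{Fop}(k)$, with local snapshot arrays $b_0,b_1,b_2$ (initially all $\mathrm{EMPTY}$): repeat forever: (1) for $x=0,1,2$ copy bucket $T_{\operatorname{sg}(x)}[a_x(k)]$ into $b_x$ slot by slot; (2) if $b_x[y]=r'_x(k)$ for some $(x,y)\in S$, return $\mathrm{FOUND}$; (3) else if $b_x[y]\ne\mathrm{EMPTY}$ for all $(x,y)\in S$, return $\mathrm{FULL}$; (4) else let $(x,y)$ be the $\prec$-minimum of $\{(x,y)\in S: b_x[y]=\mathrm{EMPTY}\}$ and execute $\mathrm{CAS}(T_{\operatorname{sg}(x)}[a_x(k)][y],\mathrm{EMPTY},r'_x(k))$; if it succeeds, return $\mathrm{PUT}$. Here $\mathrm{CAS}(s,\mathrm{EMPTY},v)$ atomically checks whether slot $s$ equals $\mathrm{EMPTY}$ and if so writes $v$ and returns true, otherwise returns false. Execution model: finitely many processes run $\mathrm{Fop}$ concurrently with their own local variables, sharing only $T$; executions are arbitrary interleavings of atomic steps, the only atomic operations on $T$ being single-slot reads and CAS.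
   Formalization: For each x ∈ {0,1,2} the map k ↦ ($a_x(k)$, $r'_x(k)$) is injective, so the bucket index and the remainder under x together determine the key. The paper assumes this as well. -}

module Defs where

open import Data.Nat using (ℕ; zero; suc; _≤_; _<_)
open import Data.Fin using (Fin; zero; suc; fromℕ<) renaming (_<_ to _<ᶠ_)
open import Data.Fin.Properties using (_≟_)
open import Data.Maybe using (Maybe; just; nothing)
open import Data.Product using (Σ; _×_; _,_; ∃; ∃-syntax)
open import Data.Sum using (_⊎_)
open import Relation.Nullary using (¬_; does)
open import Relation.Binary.PropositionalEquality using (_≡_; _≢_)
open import Relation.Binary.Construct.Closure.ReflexiveTransitive using (Star)
open import Data.Bool using (if_then_else_)

-- Table T₀ has N₀ buckets of B₀ slots, table T₁ has N₁ buckets of B₁ slots.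
-- Slots of T₀ hold EMPTY (= nothing) or a value of R₀;
-- slots of T₁ hold EMPTY (= nothing) or a value of R₁ × Fin 2
-- (the tagged remainders r'₁(k) = (r₁ k , 0), r'₂(k) = (r₂ k , 1)).

record Params : Set₁ where
  field
    K R₀ R₁ : Set
    N₀ N₁ B₀ B₁ : ℕ
    a₀ : K → Fin N₀
    a₁ a₂ : K → Fin N₁
    r₀ : K → R₀
    r₁ r₂ : K → R₁

setF : ∀ {n} {A : Set} → (Fin n → A) → Fin n → A → Fin n → A
setF f i v j = if does (i ≟ j) then v else f j

data Result : Set where
  FOUND FULL PUT : Result

module _ (π : Params) where
  open Params π

  sg : Fin 3 → Fin 2
  sg zero = zero
  sg (suc _) = suc zero

  Nb : Fin 2 → ℕ
  Nb zero = N₀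
  Nb (suc _) = N₁

  Bsz : Fin 2 → ℕ
  Bsz zero = B₀
  Bsz (suc _) = B₁

  Val : Fin 2 → Set
  Val zero = R₀
  Val (suc _) = R₁ × Fin 2

  Table : Set
  Table = (t : Fin 2) → Fin (Nb t) → Fin (Bsz t) → Maybe (Val t)

  addr : (x : Fin 3) → K → Fin (Nb (sg x))
  addr zero = a₀
  addr (suc zero) = a₁
  addr (suc (suc zero)) = a₂

  r' : (x : Fin 3) → K → Val (sg x)
  r' zero k = r₀ k
  r' (suc zero) k = r₁ k , zero
  r' (suc (suc zero)) k = r₂ k , suc zero

  slot : Table → (x : Fin 3) → K → Fin (Bsz (sg x)) → Maybe (Val (sg x))
  slot T x k y = T (sg x) (addr x k) y

  S : Set
  S = Σ (Fin 3) (λ x → Fin (Bsz (sg x)))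

  data _≺_ : S → S → Set where
    0≺1   : ∀ {y z} → (zero , y) ≺ (suc zero , z)
    0≺2   : ∀ {y z} → (zero , y) ≺ (suc (suc zero) , z)
    same  : ∀ {x y z} → y <ᶠ z → (x , y) ≺ (x , z)
    1≺2   : ∀ {y z} → Data.Fin.toℕ y < Data.Fin.toℕ z →
            (suc zero , y) ≺ (suc (suc zero) , z)
    2≺1   : ∀ {y z} → Data.Fin.toℕ z ≤ Data.Fin.toℕ y →
            (suc (suc zero) , z) ≺ (suc zero , y)

  WF-i : Table → Set
  WF-i T =
    (∀ (c : Fin N₀) (y : Fin B₀) (v : R₀) → T zero c y ≡ just v →
        ∃[ k ] (a₀ k ≡ c × r₀ k ≡ v))
    × (∀ (c : Fin N₁) (y : Fin B₁) (v : R₁ × Fin 2) → T (suc zero) c y ≡ just v →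
        ∃[ k ] ((a₁ k ≡ c × (r₁ k , zero) ≡ v) ⊎ (a₂ k ≡ c × (r₂ k , suc zero) ≡ v)))

  WF-ii : Table → Set
  WF-ii T = ∀ (k : K) (p : S) → slot T (Σ.proj₁ p) k (Σ.proj₂ p) ≡ just (r' (Σ.proj₁ p) k) →
    ∀ (p' : S) → p' ≺ p →
      (slot T (Σ.proj₁ p') k (Σ.proj₂ p') ≢ nothing)
      × (slot T (Σ.proj₁ p') k (Σ.proj₂ p') ≢ just (r' (Σ.proj₁ p') k))

  WellFormed : Table → Set
  WellFormed T = WF-i T × WF-ii T

  updT : Table → (t : Fin 2) → Fin (Nb t) → Fin (Bsz t) → Maybe (Val t) → Table
  updT T zero c y v zero = setF (T zero) c (setF (T zero c) y v)
  updT T zero c y v (suc zero) = T (suc zero)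
  updT T (suc zero) c y v zero = T zero
  updT T (suc zero) c y v (suc zero) = setF (T (suc zero)) c (setF (T (suc zero) c) y v)

  record Snap : Set where
    constructor snap
    field
      b₀ : Fin B₀ → Maybe R₀
      b₁ : Fin B₁ → Maybe (R₁ × Fin 2)
      b₂ : Fin B₁ → Maybe (R₁ × Fin 2)

  bget : Snap → (x : Fin 3) → Fin (Bsz (sg x)) → Maybe (Val (sg x))
  bget s zero = Snap.b₀ s
  bget s (suc zero) = Snap.b₁ s
  bget s (suc (suc zero)) = Snap.b₂ s

  bset : Snap → (x : Fin 3) → Fin (Bsz (sg x)) → Maybe (Val (sg x)) → Snap
  bset (snap b₀ b₁ b₂) zero y v = snap (setF b₀ y v) b₁ b₂
  bset (snap b₀ b₁ b₂) (suc zero) y v = snap b₀ (setF b₁ y v) b₂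
  bset (snap b₀ b₁ b₂) (suc (suc zero)) y v = snap b₀ b₁ (setF b₂ y v)

  emptySnap : Snap
  emptySnap = snap (λ _ → nothing) (λ _ → nothing) (λ _ → nothing)

  data PC : Set where
    read   : Fin 3 → ℕ → PC   -- step (1): next slot y of b_x to copy
    decide : PC               -- steps (2)-(4): local decision
    cas    : S → PC           -- step (4): pending CAS on the chosen slot
    ret    : Result → PC

  Local : Set
  Local = PC × Snap

  Found : K → Snap → Set
  Found k b = ∃[ p ] (bget b (Σ.proj₁ p) (Σ.proj₂ p) ≡ just (r' (Σ.proj₁ p) k))

  data LStep (k : K) : Table → Local → Table → Local → Set where
    -- copy slot y of bucket T_{sg(x)}[a_x(k)] into b_x[y] (single-slot read)
    readSlot : ∀ {T b x i} (lt : i < Bsz (sg x)) →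
      LStep k T (read x i , b) T
        (read x (suc i) , bset b x (fromℕ< lt) (slot T x k (fromℕ< lt)))
    next01 : ∀ {T b i} → i ≡ B₀ → LStep k T (read zero i , b) T (read (suc zero) 0 , b)
    next12 : ∀ {T b i} → i ≡ B₁ → LStep k T (read (suc zero) i , b) T (read (suc (suc zero)) 0 , b)
    next2d : ∀ {T b i} → i ≡ B₁ → LStep k T (read (suc (suc zero)) i , b) T (decide , b)
    found  : ∀ {T b} → Found k b → LStep k T (decide , b) T (ret FOUND , b)
    full   : ∀ {T b} → ¬ Found k b →
      (∀ (p : S) → bget b (Σ.proj₁ p) (Σ.proj₂ p) ≢ nothing) →
      LStep k T (decide , b) T (ret FULL , b)
    choose : ∀ {T b} (p : S) → ¬ Found k b →
      bget b (Σ.proj₁ p) (Σ.proj₂ p) ≡ nothing →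
      (∀ (p' : S) → p' ≺ p → bget b (Σ.proj₁ p') (Σ.proj₂ p') ≢ nothing) →
      LStep k T (decide , b) T (cas p , b)
    casOk  : ∀ {T b} (x : Fin 3) (y : Fin (Bsz (sg x))) →
      slot T x k y ≡ nothing →
      LStep k T (cas (x , y) , b)
        (updT T (sg x) (addr x k) y (just (r' x k))) (ret PUT , b)
    casFail : ∀ {T b} (x : Fin 3) (y : Fin (Bsz (sg x))) →
      slot T x k y ≢ nothing →
      LStep k T (cas (x , y) , b) T (read zero 0 , b)

  Config : ℕ → Set
  Config P = Table × (Fin P → Local)

  data Step {P : ℕ} (key : Fin P → K) : Config P → Config P → Set where
    step : ∀ {T T' ls l'} (p : Fin P) →
      LStep (key p) T (ls p) T' l' →
      Step key (T , ls) (T' , setF ls p l')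

  init : {P : ℕ} → Table → Config P
  init T = T , (λ _ → read zero 0 , emptySnap)

  Reachable : {P : ℕ} (key : Fin P → K) → Table → Config P → Set
  Reachable key T₀ C = Star (Step key) (init T₀) C

  QuotientInjective : Set
  QuotientInjective = ∀ (x : Fin 3) (k k' : K) →
    addr x k ≡ addr x k' → r' x k ≡ r' x k' → k ≡ k'

{-# OPTIONS --safe #-}
-- A slot is only ever written by a CAS from EMPTY, so the table only grows: a filled slot
-- never changes. Hence every process keeps two facts true: each non-EMPTY entry of its
-- snapshot is still in the table, and while its CAS on position p is pending, every
-- position before p in ≺ holds a value other than r'(k) (the snapshot showed it filled,
-- and it was not r'(k) since the search failed). The CAS then establishes (ii) for k at p,
-- and since (a_x(k), r'_x(k)) determines k, it creates no new entry of any other key,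
-- whose old entries keep their filled predecessors.
module Submission where

open import Defs
open import Data.Nat using (ℕ; _≤_)
open import Data.Fin using (Fin; zero; suc; fromℕ<)
open import Data.Fin.Properties using (_≟_)
open import Data.Product using (_×_; proj₁; proj₂; _,_; ∃-syntax)
open import Data.Sum using (_⊎_; inj₁; inj₂)
open import Data.Maybe using (Maybe; just; nothing)
open import Data.Maybe.Properties using (just-injective)
open import Function using (_∘_; id)
open import Relation.Nullary using (¬_; yes; no; contradiction)
open import Relation.Binary.PropositionalEquality using (_≡_; _≢_; refl; sym; trans; cong-app)
open import Relation.Binary.Construct.Closure.ReflexiveTransitive using (fold)

setF-point : ∀ {n} {A : Set} (f : Fin n → A) i v j →
  (i ≡ j × setF f i v j ≡ v) ⊎ setF f i v j ≡ f j
setF-point f i v j with i ≟ j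
... | yes i≡j = inj₁ (i≡j , refl)
... | no _    = inj₂ refl

setF-agrees : ∀ {n} {A : Set} (f g : Fin n → A) i j →
  setF f i (g i) j ≡ g j ⊎ setF f i (g i) j ≡ f j
setF-agrees f g i j with i ≟ j
... | yes refl = inj₁ refl
... | no _     = inj₂ refl

setF²-point : ∀ {m n} {A : Set} (f : Fin m → Fin n → A) i j v i′ j′ →
  (i ≡ i′ × j ≡ j′ × setF f i (setF (f i) j v) i′ j′ ≡ v)
  ⊎ setF f i (setF (f i) j v) i′ j′ ≡ f i′ j′
setF²-point f i j v i′ j′ with setF-point f i (setF (f i) j v) i′
... | inj₂ row = inj₂ (cong-app row j′)
... | inj₁ (refl , row) with setF-point (f i) j v j′
...   | inj₁ (refl , cell) = inj₁ (refl , refl , trans (cong-app row j) cell)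
...   | inj₂ cell          = inj₂ (trans (cong-app row j′) cell)

module _ (π : Params) where
  open Params π

  updT-point : ∀ (T : Table π) t c y v c′ y′ →
    (c ≡ c′ × y ≡ y′ × updT π T t c y v t c′ y′ ≡ v) ⊎ updT π T t c y v t c′ y′ ≡ T t c′ y′
  updT-point T zero       = setF²-point (T zero)
  updT-point T (suc zero) = setF²-point (T (suc zero))

  updT-filled : ∀ (T : Table π) t c y v c′ y′ w → updT π T t c y v t c′ y′ ≡ just w →
    (c ≡ c′ × y ≡ y′ × v ≡ just w) ⊎ T t c′ y′ ≡ just w
  updT-filled T t c y v c′ y′ w filled with updT-point T t c y v c′ y′
  ... | inj₁ (c≡c′ , y≡y′ , new) = inj₁ (c≡c′ , y≡y′ , trans (sym new) filled)
  ... | inj₂ old                 = inj₂ (trans (sym old) filled)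

  _⊑_ : Table π → Table π → Set
  T ⊑ T′ = ∀ t c y w → T t c y ≡ just w → T′ t c y ≡ just w

  ⊑-refl : ∀ {T} → T ⊑ T
  ⊑-refl _ _ _ _ = id

  updT-keeps : ∀ (T : Table π) t c y v c′ y′ w → T t c y ≡ nothing →
    T t c′ y′ ≡ just w → updT π T t c y v t c′ y′ ≡ just w
  updT-keeps T t c y v c′ y′ w empty filled with updT-point T t c y v c′ y′
  ... | inj₁ (refl , refl , _) = contradiction (trans (sym empty) filled) λ ()
  ... | inj₂ old               = trans old filled

  updT-grows : ∀ (T : Table π) t c y v → T t c y ≡ nothing → T ⊑ updT π T t c y v
  updT-grows T zero       c y v empty zero       c′ y′ w = updT-keeps T zero c y v c′ y′ w empty
  updT-grows T zero       c y v empty (suc zero) c′ y′ w = id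
  updT-grows T (suc zero) c y v empty zero       c′ y′ w = id
  updT-grows T (suc zero) c y v empty (suc zero) c′ y′ w = updT-keeps T (suc zero) c y v c′ y′ w empty

  Holds : Table π → K → S π → Set
  Holds T k p = slot π T (proj₁ p) k (proj₂ p) ≡ just (r' π (proj₁ p) k)

  Blocked : Table π → K → S π → Set
  Blocked T k p = slot π T (proj₁ p) k (proj₂ p) ≢ nothing
                × slot π T (proj₁ p) k (proj₂ p) ≢ just (r' π (proj₁ p) k)

  blocked-mono : ∀ {T T′ k} → T ⊑ T′ → ∀ p → Blocked T k p → Blocked T′ k p
  blocked-mono {T} {T′} {k} T⊑T′ (x , y) (nonempty , other) with slot π T x k y in filled
  ... | nothing = contradiction refl nonempty
  ... | just w rewrite T⊑T′ (sg π x) (addr π x k) y w filled = (λ ()) , other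

  fill : Table π → K → (x : Fin 3) → Fin (Bsz π (sg π x)) → Table π
  fill T k x y = updT π T (sg π x) (addr π x k) y (just (r' π x k))

  fill-grows : ∀ T k x y → slot π T x k y ≡ nothing → T ⊑ fill T k x y
  fill-grows T k x y = updT-grows T (sg π x) (addr π x k) y (just (r' π x k))

  Origin : (t : Fin 2) → Fin (Nb π t) → Val π t → Set
  Origin zero       c v = ∃[ k ] (a₀ k ≡ c × r₀ k ≡ v)
  Origin (suc zero) c v = ∃[ k ] ((a₁ k ≡ c × (r₁ k , zero) ≡ v) ⊎ (a₂ k ≡ c × (r₂ k , suc zero) ≡ v))

  -- WF-i π T unfolds to Sourced T zero × Sourced T (suc zero).
  Sourced : Table π → Fin 2 → Set
  Sourced T t = ∀ c y v → T t c y ≡ just v → Origin t c v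

  r'-origin : ∀ x k → Origin (sg π x) (addr π x k) (r' π x k)
  r'-origin zero             k = k , refl , refl
  r'-origin (suc zero)       k = k , inj₁ (refl , refl)
  r'-origin (suc (suc zero)) k = k , inj₂ (refl , refl)

  fill-sourced : ∀ T k x y → Sourced T (sg π x) → Sourced (fill T k x y) (sg π x)
  fill-sourced T k x y sourced c y′ v filled
    with updT-filled T (sg π x) (addr π x k) y (just (r' π x k)) c y′ v filled
  ... | inj₁ (refl , _ , refl) = r'-origin x k
  ... | inj₂ old               = sourced c y′ v old

  fill-WF-i : ∀ T k x y → WF-i π T → WF-i π (fill T k x y)
  fill-WF-i T k zero             y (wf₀ , wf₁) = fill-sourced T k zero y wf₀ , wf₁
  fill-WF-i T k (suc zero)       y (wf₀ , wf₁) = wf₀ , fill-sourced T k (suc zero) y wf₁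
  fill-WF-i T k (suc (suc zero)) y (wf₀ , wf₁) = wf₀ , fill-sourced T k (suc (suc zero)) y wf₁

  bget-bset : ∀ b x y (g : (x : Fin 3) → Fin (Bsz π (sg π x)) → Maybe (Val π (sg π x))) x′ y′ →
    bget π (bset π b x y (g x y)) x′ y′ ≡ g x′ y′
    ⊎ bget π (bset π b x y (g x y)) x′ y′ ≡ bget π b x′ y′
  bget-bset (snap b₀ b₁ b₂) zero             y g zero             y′ = setF-agrees b₀ (g zero) y y′
  bget-bset (snap b₀ b₁ b₂) zero             y g (suc zero)       y′ = inj₂ refl
  bget-bset (snap b₀ b₁ b₂) zero             y g (suc (suc zero)) y′ = inj₂ refl
  bget-bset (snap b₀ b₁ b₂) (suc zero)       y g zero             y′ = inj₂ refl
  bget-bset (snap b₀ b₁ b₂) (suc zero)       y g (suc zero)       y′ = setF-agrees b₁ (g (suc zero)) y y′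
  bget-bset (snap b₀ b₁ b₂) (suc zero)       y g (suc (suc zero)) y′ = inj₂ refl
  bget-bset (snap b₀ b₁ b₂) (suc (suc zero)) y g zero             y′ = inj₂ refl
  bget-bset (snap b₀ b₁ b₂) (suc (suc zero)) y g (suc zero)       y′ = inj₂ refl
  bget-bset (snap b₀ b₁ b₂) (suc (suc zero)) y g (suc (suc zero)) y′ = setF-agrees b₂ (g (suc (suc zero))) y y′

  SnapshotSound : Table π → K → Snap π → Set
  SnapshotSound T k b = ∀ p w → bget π b (proj₁ p) (proj₂ p) ≡ just w →
    slot π T (proj₁ p) k (proj₂ p) ≡ just w

  PendingCASSafe : Table π → K → PC π → Set
  PendingCASSafe T k pc = ∀ {q} → pc ≡ cas q → ∀ p → _≺_ π p q → Blocked T k p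

  ProcessInv : Table π → K → Local π → Set
  ProcessInv T k (pc , b) = SnapshotSound T k b × PendingCASSafe T k pc

  emptySnap-sound : ∀ T k → SnapshotSound T k (emptySnap π)
  emptySnap-sound T k (zero           , _) _ ()
  emptySnap-sound T k (suc zero       , _) _ ()
  emptySnap-sound T k (suc (suc zero) , _) _ ()

  snapshotSound-read : ∀ T k b → SnapshotSound T k b → ∀ x y →
    SnapshotSound T k (bset π b x y (slot π T x k y))
  snapshotSound-read T k b sound x y p w seen
    with bget-bset b x y (λ x′ y′ → slot π T x′ k y′) (proj₁ p) (proj₂ p)
  ... | inj₁ copied    = trans (sym copied) seen
  ... | inj₂ untouched = sound p w (trans (sym untouched) seen)

  snapshot-blocked : ∀ T k b → SnapshotSound T k b → ¬ Found π k b →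
    ∀ p → bget π b (proj₁ p) (proj₂ p) ≢ nothing → Blocked T k p
  snapshot-blocked T k b sound notFound p occupied with bget π b (proj₁ p) (proj₂ p) in seen
  ... | nothing = contradiction refl occupied
  ... | just w rewrite sound p w seen = (λ ()) , λ same → notFound (p , trans seen same)

  processInv-mono : ∀ {T T′ k} → T ⊑ T′ → ∀ l → ProcessInv T k l → ProcessInv T′ k l
  processInv-mono T⊑T′ (pc , b) (sound , safe) =
    (λ p w → T⊑T′ _ _ _ w ∘ sound p w) , λ pc≡cas p p≺q → blocked-mono T⊑T′ p (safe pc≡cas p p≺q)

  lstep-grows : ∀ {k T l T′ l′} → LStep π k T l T′ l′ → T ⊑ T′
  lstep-grows {k} {T} (casOk x y empty) = fill-grows T k x y empty
  lstep-grows (readSlot _)       = ⊑-refl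
  lstep-grows (next01 _)         = ⊑-refl
  lstep-grows (next12 _)         = ⊑-refl
  lstep-grows (next2d _)         = ⊑-refl
  lstep-grows (found _)          = ⊑-refl
  lstep-grows (full _ _)         = ⊑-refl
  lstep-grows (choose _ _ _ _)   = ⊑-refl
  lstep-grows (casFail _ _ _)    = ⊑-refl

  lstep-processInv : ∀ {k T l T′ l′} → LStep π k T l T′ l′ → ProcessInv T k l → ProcessInv T′ k l′
  lstep-processInv {k} {T} (readSlot {b = b} {x = x} lt) (sound , _) =
    snapshotSound-read T k b sound x (fromℕ< lt) , λ ()
  lstep-processInv (next01 _)       (sound , _) = sound , λ ()
  lstep-processInv (next12 _)       (sound , _) = sound , λ ()
  lstep-processInv (next2d _)       (sound , _) = sound , λ ()
  lstep-processInv (found _)        (sound , _) = sound , λ ()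
  lstep-processInv (full _ _)       (sound , _) = sound , λ ()
  lstep-processInv {k} {T} (choose {b = b} p notFound _ below) (sound , _) =
    sound , λ { refl p′ p′≺p → snapshot-blocked T k b sound notFound p′ (below p′ p′≺p) }
  lstep-processInv {k} {T} (casOk x y empty) (sound , _) =
    processInv-mono (fill-grows T k x y empty) (ret PUT , _) (sound , λ ())
  lstep-processInv (casFail _ _ _)  (sound , _) = sound , λ ()

  Invariant : ∀ {P} → (Fin P → K) → Config π P → Set
  Invariant key (T , ls) = WellFormed π T × ∀ i → ProcessInv T (key i) (ls i)

  module _ (qi : QuotientInjective π) where

    fill-holds-diagonal : ∀ T k x y k′ y′ → Holds (fill T k x y) k′ (x , y′) →
      Holds T k′ (x , y′) ⊎ (k′ ≡ k × _≡_ {A = S π} (x , y′) (x , y))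
    fill-holds-diagonal T k x y k′ y′ holds
      with updT-filled T (sg π x) (addr π x k) y (just (r' π x k)) (addr π x k′) y′ (r' π x k′) holds
    ... | inj₁ (same-addr , refl , same-r') =
      inj₂ (qi x k′ k (sym same-addr) (sym (just-injective same-r')) , refl)
    ... | inj₂ old                          = inj₁ old

    fill-holds : ∀ T k x y k′ p → Holds (fill T k x y) k′ p → Holds T k′ p ⊎ (k′ ≡ k × p ≡ (x , y))
    fill-holds T k zero             y k′ (zero , y′)             = fill-holds-diagonal T k zero y k′ y′
    fill-holds T k (suc zero)       y k′ (suc zero , y′)         = fill-holds-diagonal T k (suc zero) y k′ y′
    fill-holds T k (suc (suc zero)) y k′ (suc (suc zero) , y′)   = fill-holds-diagonal T k (suc (suc zero)) y k′ y′
    fill-holds T k zero             y k′ (suc zero , y′)         = inj₁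
    fill-holds T k zero             y k′ (suc (suc zero) , y′)   = inj₁
    fill-holds T k (suc zero)       y k′ (zero , y′)             = inj₁
    fill-holds T k (suc (suc zero)) y k′ (zero , y′)             = inj₁
    fill-holds T k (suc zero)       y k′ (suc (suc zero) , y′) holds
      with updT-filled T (suc zero) (a₁ k) y (just (r₁ k , zero)) (a₂ k′) y′ (r₂ k′ , suc zero) holds
    ... | inj₁ (_ , _ , ())
    ... | inj₂ old = inj₁ old
    fill-holds T k (suc (suc zero)) y k′ (suc zero , y′) holds
      with updT-filled T (suc zero) (a₂ k) y (just (r₂ k , suc zero)) (a₁ k′) y′ (r₁ k′ , zero) holds
    ... | inj₁ (_ , _ , ())
    ... | inj₂ old = inj₁ old

    fill-wellFormed : ∀ T k x y → slot π T x k y ≡ nothing →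
      (∀ p → _≺_ π p (x , y) → Blocked T k p) → WellFormed π T → WellFormed π (fill T k x y)
    fill-wellFormed T k x y empty below (wf-i , wf-ii) = fill-WF-i T k x y wf-i , order
      where
        grows : T ⊑ fill T k x y
        grows = fill-grows T k x y empty

        order : WF-ii π (fill T k x y)
        order k′ p holds p′ p′≺p with fill-holds T k x y k′ p holds
        ... | inj₁ old           = blocked-mono grows p′ (wf-ii k′ p old p′ p′≺p)
        ... | inj₂ (refl , refl) = blocked-mono grows p′ (below p′ p′≺p)

    lstep-wellFormed : ∀ {k T l T′ l′} → LStep π k T l T′ l′ →
      ProcessInv T k l → WellFormed π T → WellFormed π T′
    lstep-wellFormed {k} {T} (casOk x y empty) (_ , safe) = fill-wellFormed T k x y empty (safe refl)
    lstep-wellFormed (readSlot _)     _ = id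
    lstep-wellFormed (next01 _)       _ = id
    lstep-wellFormed (next12 _)       _ = id
    lstep-wellFormed (next2d _)       _ = id
    lstep-wellFormed (found _)        _ = id
    lstep-wellFormed (full _ _)       _ = id
    lstep-wellFormed (choose _ _ _ _) _ = id
    lstep-wellFormed (casFail _ _ _)  _ = id

    module _ {P : ℕ} (key : Fin P → K) where

      step-invariant : ∀ {C C′} → Step π key C C′ → Invariant key C → Invariant key C′
      step-invariant (step {T} {T′} {ls} {l′} i s) (wf , inv) = lstep-wellFormed s (inv i) wf , inv′
        where
          inv′ : ∀ j → ProcessInv T′ (key j) (setF ls i l′ j)
          inv′ j with i ≟ j
          ... | yes refl = lstep-processInv s (inv i)
          ... | no _     = processInv-mono (lstep-grows s) (ls j) (inv j)

      reachable-invariant : ∀ {C} T₀ → WellFormed π T₀ → Reachable π key T₀ C → Invariant key C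
      reachable-invariant T₀ wf reachable =
        fold (λ C C′ → Invariant key C → Invariant key C′) (λ s next → next ∘ step-invariant s) id
          reachable (wf , λ i → emptySnap-sound T₀ (key i) , λ ())

lemma3 : (π : Params) → 1 ≤ Params.B₀ π → 1 ≤ Params.B₁ π →
    QuotientInjective π →
    (P : ℕ) (key : Fin P → Params.K π) (T₀ : Table π) → WellFormed π T₀ →
    ∀ (C C' : Config π P) → Reachable π key T₀ C → Step π key C C' →
    WellFormed π (proj₁ C) × WellFormed π (proj₁ C')
lemma3 π _ _ qi P key T₀ wf C C′ reachable s = proj₁ inv , proj₁ (step-invariant π qi key s inv)
  where
    inv : Invariant π key C
    inv = reachable-invariant π qi key T₀ wf reachable
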